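{- Let $p>1$ be an integer and let $u^{(p)}$ be the fixed point of the substitution $\varphi_p(L)=L^pS$, $\varphi_p(S)=M$, $\varphi_p(M)=L^{p-1}S$ starting with $L$. Then its Abelian complexity satisfies $\mathrm{AC}(n)\ge 3$ for all $n\in\mathbb N$.
   Context: For a finite word $w$ over $\{L,S,M\}$, its Parikh vector is $\Psi(w)=(|w|_L,|w|_S,|w|_M)$, where $|w|_a$ is the number of occurrences of the letter $a$. The Abelian complexity $\mathrm{AC}(n)$ of $u^{(p)}$ is the number of distinct Parikh vectors of factors (finite contiguous blocks) of $u^{(p)}$ of length $n$. -}

module Defs where

open import Data.Nat using (ℕ; zero; suc; _+_)
open import Data.List using (List; []; _∷_; _++_; replicate; concatMap)
open import Data.Product using (_×_; _,_)
open import Function using (_∘_)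

data Letter : Set where
  L S M : Letter

-- The substitution φ_p : L ↦ L^p S, S ↦ M, M ↦ L^(p-1) S
-- (L^(p-1) written by matching p = suc q; the p = 0 clause is irrelevant since p > 1)
φ-letter : ℕ → Letter → List Letter
φ-letter p L = replicate p L ++ (S ∷ [])
φ-letter p S = M ∷ []
φ-letter zero M = S ∷ []
φ-letter (suc q) M = replicate q L ++ (S ∷ [])

φ : ℕ → List Letter → List Letter
φ p = concatMap (φ-letter p)

φ-iter-L : ℕ → ℕ → List Letter
φ-iter-L p zero = L ∷ []
φ-iter-L p (suc k) = φ p (φ-iter-L p k)

-- lookup with a default letter (the default is never used for the fixed point
-- since |φ_p^(i+1)(L)| > i when p > 1)
nth : List Letter → ℕ → Letter
nth [] _ = L
nth (x ∷ xs) zero = x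
nth (x ∷ xs) (suc i) = nth xs i

-- The fixed point u^(p) = lim φ_p^k(L): its i-th letter (0-indexed) is the
-- i-th letter of φ_p^(i+1)(L), each φ_p^k(L) being a prefix of φ_p^(k+1)(L).
u : ℕ → ℕ → Letter
u p i = nth (φ-iter-L p (suc i)) i

factor : ℕ → ℕ → ℕ → List Letter
factor p i zero = []
factor p i (suc n) = u p i ∷ factor p (suc i) n

Parikh : Set
Parikh = ℕ × ℕ × ℕ

Ψ : List Letter → Parikh
Ψ [] = 0 , 0 , 0
Ψ (L ∷ w) with Ψ w
... | a , b , c = suc a , b , c
Ψ (S ∷ w) with Ψ w
... | a , b , c = a , suc b , c
Ψ (M ∷ w) with Ψ w
... | a , b , c = a , b , suc c

-- If the indicator of a letter c in u were n-periodic, every factor of length n would contain the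
-- same number k of c's, so the deviation n·|w|_c − k·|w| would stay bounded (by n²) on all prefixes w
-- of u, in particular on the prefixes φ^a(L). These deviations are the weights of φ^a(L) under a
-- letter weight, so they satisfy x(a+3) = p·x(a+2) + x(a+1) − x(a), the recurrence of the
-- characteristic polynomial t³ − p t² − t + 1 of φ. Along any nonzero solution the quadratic form
-- V(a) = 2·x(a+2)·x(a+1) − x(a)² − x(a+1)² increases by a sum of squares at each step, and by at
-- least 1 every two steps, so x is unbounded: no letter indicator is n-periodic.
-- Sliding a factor from i to i+1 changes its count of a letter d exactly when d is one of u(i),
-- u(i+n) but not both. Take i with u(i) ≠ u(i+n) and let d be the third letter: the factors at i and
-- i+1 differ in their count of u(i) but agree in their count of d, and a position j where the
-- indicator of d breaks period n gives a factor at j or j+1 whose count of d differs from theirs.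

module Submission where

open import Defs
open import Data.Nat using (ℕ; zero; suc; _+_; _*_; _∸_; _⊔_; _≤_; _<_; _≤?_; z≤n; s≤s; z<s; _≤′_; ≤′-refl; ≤′-step)
open import Data.Nat.Properties
open import Data.Nat.Induction using (<-rec)
import Data.Nat.Tactic.RingSolver as ℕ-Solver
open import Data.Integer as ℤ using (ℤ; +_; -[1+_]; 0ℤ; 1ℤ; ∣_∣; _⊖_)
import Data.Integer.Properties as ℤP
open import Data.Integer.Tactic.RingSolver using (solve-∀)
open import Data.List using (List; []; _∷_; _++_; [_]; replicate; length; concatMap)
import Data.List.Properties as List
open import Data.Product using (Σ; ∃-syntax; _×_; _,_; proj₁; proj₂; uncurry)
open import Data.Sum using (inj₁; inj₂)
open import Function using (_∘_)
open import Relation.Binary.Definitions using (DecidableEquality)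
open import Relation.Binary.PropositionalEquality hiding ([_])
open import Relation.Nullary using (¬_; Dec; yes; no; ¬?; contradiction)
open import Relation.Nullary.Decidable using (decidable-stable)

_≟ᴸ_ : DecidableEquality Letter
L ≟ᴸ L = yes refl
L ≟ᴸ S = no λ ()
L ≟ᴸ M = no λ ()
S ≟ᴸ L = no λ ()
S ≟ᴸ S = yes refl
S ≟ᴸ M = no λ ()
M ≟ᴸ L = no λ ()
M ≟ᴸ S = no λ ()
M ≟ᴸ M = yes refl

letter-avoiding : (a b : Letter) → ∃[ c ] c ≢ a × c ≢ b
letter-avoiding L L = S , (λ ()) , (λ ())
letter-avoiding L S = M , (λ ()) , (λ ())
letter-avoiding L M = S , (λ ()) , (λ ())
letter-avoiding S L = M , (λ ()) , (λ ())
letter-avoiding S S = L , (λ ()) , (λ ())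
letter-avoiding S M = L , (λ ()) , (λ ())
letter-avoiding M L = S , (λ ()) , (λ ())
letter-avoiding M S = L , (λ ()) , (λ ())
letter-avoiding M M = L , (λ ()) , (λ ())

δ : Letter → Letter → ℕ
δ c d with c ≟ᴸ d
... | yes _ = 1
... | no  _ = 0

δ-refl : ∀ c → δ c c ≡ 1
δ-refl c with c ≟ᴸ c
... | yes _   = refl
... | no c≢c = contradiction refl c≢c

δ-≢ : ∀ {c d} → c ≢ d → δ c d ≡ 0
δ-≢ {c} {d} c≢d with c ≟ᴸ d
... | yes c≡d = contradiction c≡d c≢d
... | no  _   = refl

δ≤1 : ∀ c d → δ c d ≤ 1
δ≤1 c d with c ≟ᴸ d
... | yes _ = ≤-refl
... | no  _ = z≤n

count : Letter → List Letter → ℕ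
count c []      = 0
count c (d ∷ w) = δ c d + count c w

count-++ : ∀ c w w′ → count c (w ++ w′) ≡ count c w + count c w′
count-++ c []      w′ = refl
count-++ c (d ∷ w) w′ = trans (cong (_+_ (δ c d)) (count-++ c w w′)) (sym (+-assoc (δ c d) _ _))

count≤length : ∀ c w → count c w ≤ length w
count≤length c []      = z≤n
count≤length c (d ∷ w) = +-mono-≤ (δ≤1 c d) (count≤length c w)

component : Letter → Parikh → ℕ
component L (l , _ , _) = l
component S (_ , s , _) = s
component M (_ , _ , m) = m

Ψ≡counts : ∀ w → Ψ w ≡ (count L w , count S w , count M w)
Ψ≡counts []      = refl
Ψ≡counts (L ∷ w) rewrite Ψ≡counts w = refl
Ψ≡counts (S ∷ w) rewrite Ψ≡counts w = refl
Ψ≡counts (M ∷ w) rewrite Ψ≡counts w = refl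

component-Ψ : ∀ c w → component c (Ψ w) ≡ count c w
component-Ψ L w rewrite Ψ≡counts w = refl
component-Ψ S w rewrite Ψ≡counts w = refl
component-Ψ M w rewrite Ψ≡counts w = refl

count-≢⇒Ψ-≢ : ∀ c {w w′} → count c w ≢ count c w′ → Ψ w ≢ Ψ w′
count-≢⇒Ψ-≢ c {w} {w′} counts≢ Ψ≡ =
  counts≢ (trans (sym (component-Ψ c w)) (trans (cong (component c) Ψ≡) (component-Ψ c w′)))

window : {A : Set} → (ℕ → A) → ℕ → ℕ → List A
window v i zero    = []
window v i (suc n) = v i ∷ window v (suc i) n

factor≡window : ∀ p i n → factor p i n ≡ window (u p) i n
factor≡window p i zero    = refl
factor≡window p i (suc n) = cong (u p i ∷_) (factor≡window p (suc i) n)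

module _ {A : Set} where

  length-window : ∀ (v : ℕ → A) i n → length (window v i n) ≡ n
  length-window v i zero    = refl
  length-window v i (suc n) = cong suc (length-window v (suc i) n)

  window-suc : ∀ (v : ℕ → A) i n → window v (suc i) n ≡ window (v ∘ suc) i n
  window-suc v i zero    = refl
  window-suc v i (suc n) = cong (v (suc i) ∷_) (window-suc v (suc i) n)

  window-+ : ∀ (v : ℕ → A) i m n → window v i (m + n) ≡ window v i m ++ window v (i + m) n
  window-+ v i zero    n rewrite +-identityʳ i = refl
  window-+ v i (suc m) n rewrite window-+ v (suc i) m n | +-suc i m = refl

  window-snoc : ∀ (v : ℕ → A) i n → window v i (suc n) ≡ window v i n ++ [ v (i + n) ]
  window-snoc v i n = trans (cong (window v i) (+-comm 1 n)) (window-+ v i n 1)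

nth-++ : ∀ w w′ {t} → t < length w → nth (w ++ w′) t ≡ nth w t
nth-++ (d ∷ w) w′ {zero}  _         = refl
nth-++ (d ∷ w) w′ {suc t} (s≤s t<) = nth-++ w w′ t<

window-nth : ∀ v w → (∀ t → t < length w → v t ≡ nth w t) → window v 0 (length w) ≡ w
window-nth v []      _     = refl
window-nth v (d ∷ w) v≡nth =
  cong₂ _∷_ (v≡nth 0 z<s)
    (trans (window-suc v 0 (length w)) (window-nth (v ∘ suc) w (λ t t< → v≡nth (suc t) (s≤s t<))))

module _ (v : ℕ → Letter) (c : Letter) where

  count-window-slide : ∀ i n →
    count c (window v (suc i) n) + δ c (v i) ≡ count c (window v i n) + δ c (v (i + n))
  count-window-slide i n = begin
    count c (window v (suc i) n) + δ c (v i)          ≡⟨ +-comm _ (δ c (v i)) ⟩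
    count c (window v i (suc n))                      ≡⟨ cong (count c) (window-snoc v i n) ⟩
    count c (window v i n ++ [ v (i + n) ])           ≡⟨ count-++ c (window v i n) _ ⟩
    count c (window v i n) + (δ c (v (i + n)) + 0)   ≡⟨ cong (_+_ (count c (window v i n))) (+-identityʳ _) ⟩
    count c (window v i n) + δ c (v (i + n))          ∎
    where open ≡-Reasoning

  count-window-suc≡⇒δ≡ : ∀ i n → count c (window v (suc i) n) ≡ count c (window v i n) →
                          δ c (v i) ≡ δ c (v (i + n))
  count-window-suc≡⇒δ≡ i n counts≡ =
    +-cancelˡ-≡ _ _ _ (trans (cong (_+ δ c (v i)) (sym counts≡)) (count-window-slide i n))

  δ≡⇒count-window-suc≡ : ∀ i n → δ c (v i) ≡ δ c (v (i + n)) →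
                          count c (window v (suc i) n) ≡ count c (window v i n)
  δ≡⇒count-window-suc≡ i n δ≡ =
    +-cancelʳ-≡ _ _ _ (trans (count-window-slide i n) (cong (_+_ (count c (window v i n))) (sym δ≡)))

ThreeParikhVectors : (ℕ → List Letter) → Set
ThreeParikhVectors F = Σ ℕ λ i → Σ ℕ λ j → Σ ℕ λ k →
  (Ψ (F i) ≢ Ψ (F j)) × (Ψ (F i) ≢ Ψ (F k)) × (Ψ (F j) ≢ Ψ (F k))

ThreeParikhVectors-cong : ∀ {F G} → (∀ i → F i ≡ G i) → ThreeParikhVectors F → ThreeParikhVectors G
ThreeParikhVectors-cong {F} {G} F≡G (i , j , k , i≢j , i≢k , j≢k) =
  i , j , k , transport i≢j , transport i≢k , transport j≢k
  where
  transport : ∀ {i j} → Ψ (F i) ≢ Ψ (F j) → Ψ (G i) ≢ Ψ (G j)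
  transport {i} {j} = subst₂ (λ w w′ → Ψ w ≢ Ψ w′) (F≡G i) (F≡G j)

three-Parikh-vectors-in-windows : ∀ (v : ℕ → Letter) n → (∀ c → ∃[ j ] δ c (v j) ≢ δ c (v (j + n))) →
  ThreeParikhVectors (λ i → window v i n)
three-Parikh-vectors-in-windows v n aperiodic
  with i , L-breaks ← aperiodic L
  with c , c≢vᵢ , c≢vᵢ₊ₙ ← letter-avoiding (v i) (v (i + n))
  with j , c-breaks ← aperiodic c
  = i , suc i , proj₁ differs ,
    count-≢⇒Ψ-≢ (v i) (vᵢ-count-changes ∘ sym) ,
    count-≢⇒Ψ-≢ c (proj₂ differs) ,
    count-≢⇒Ψ-≢ c (proj₂ differs ∘ trans (sym c-count-stays))
  where
  C : Letter → ℕ → ℕ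
  C d m = count d (window v m n)
  vᵢ-count-changes : C (v i) (suc i) ≢ C (v i) i
  vᵢ-count-changes counts≡ = 1+n≢0 (begin
    1                      ≡⟨ δ-refl (v i) ⟨
    δ (v i) (v i)          ≡⟨ count-window-suc≡⇒δ≡ v (v i) i n counts≡ ⟩
    δ (v i) (v (i + n))    ≡⟨ δ-≢ (L-breaks ∘ cong (δ L)) ⟩
    0                      ∎)
    where open ≡-Reasoning
  c-count-stays : C c (suc i) ≡ C c i
  c-count-stays = δ≡⇒count-window-suc≡ v c i n (trans (δ-≢ c≢vᵢ) (sym (δ-≢ c≢vᵢ₊ₙ)))
  differs : ∃[ k ] C c i ≢ C c k
  differs with C c i ≟ C c j
  ... | yes i≡j = suc j , λ i≡j+1 → c-breaks (count-window-suc≡⇒δ≡ v c j n (trans (sym i≡j+1) i≡j))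
  ... | no  i≢j = j , i≢j

weight : {A : Set} → (A → ℤ) → List A → ℤ
weight g []      = 0ℤ
weight g (x ∷ w) = g x ℤ.+ weight g w

module _ {A : Set} (g : A → ℤ) where

  weight-++ : ∀ w w′ → weight g (w ++ w′) ≡ weight g w ℤ.+ weight g w′
  weight-++ []      w′ = sym (ℤP.+-identityˡ _)
  weight-++ (x ∷ w) w′ = trans (cong (ℤ._+_ (g x)) (weight-++ w w′)) (sym (ℤP.+-assoc (g x) _ _))

  weight-replicate : ∀ m x → weight g (replicate m x) ≡ + m ℤ.* g x
  weight-replicate zero    x = refl
  weight-replicate (suc m) x = trans (cong (ℤ._+_ (g x)) (weight-replicate m x)) (sym (ℤP.suc-* (+ m) (g x)))

  weight-concatMap : ∀ {B : Set} (f : B → List A) w → weight g (concatMap f w) ≡ weight (weight g ∘ f) w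
  weight-concatMap f []      = refl
  weight-concatMap f (x ∷ w) = trans (weight-++ (f x) (concatMap f w)) (cong (ℤ._+_ (weight g (f x))) (weight-concatMap f w))

deviation : ℕ → ℕ → Letter → Letter → ℤ
deviation n k c d = + n ℤ.* + δ c d ℤ.- + k

weight-deviation : ∀ n k c w → weight (deviation n k c) w ≡ + n ℤ.* + count c w ℤ.- + k ℤ.* + length w
weight-deviation n k c []      = vanish (+ n) (+ k)
  where
  vanish : ∀ n k → 0ℤ ≡ n ℤ.* 0ℤ ℤ.- k ℤ.* 0ℤ
  vanish = solve-∀
weight-deviation n k c (d ∷ w) = trans (cong (ℤ._+_ (deviation n k c d)) (weight-deviation n k c w))
                                       (expand (+ n) (+ k) (+ δ c d) (+ count c w) (+ length w))
  where
  expand : ∀ n k e x ℓ → (n ℤ.* e ℤ.- k) ℤ.+ (n ℤ.* x ℤ.- k ℤ.* ℓ) ≡ n ℤ.* (e ℤ.+ x) ℤ.- k ℤ.* (1ℤ ℤ.+ ℓ)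
  expand = solve-∀

deviation-nonvanishing : ∀ {n} k c → 1 ≤ n → ¬ (∀ d → deviation n k c d ≡ 0ℤ)
deviation-nonvanishing {n} k c 1≤n vanishes = contradiction (≤-trans 1≤n (≤-reflexive (cong ∣_∣ n≡0))) λ ()
  where
  d : Letter
  d = proj₁ (letter-avoiding c c)
  c≢d : c ≢ d
  c≢d = proj₁ (proj₂ (letter-avoiding c c)) ∘ sym
  difference : ∀ n k → n ≡ (n ℤ.* 1ℤ ℤ.- k) ℤ.- (n ℤ.* 0ℤ ℤ.- k)
  difference = solve-∀
  n≡0 : + n ≡ 0ℤ
  n≡0 = begin
    + n                                               ≡⟨ difference (+ n) (+ k) ⟩
    (+ n ℤ.* 1ℤ ℤ.- + k) ℤ.- (+ n ℤ.* 0ℤ ℤ.- + k)      ≡⟨ cong₂ (λ e e′ → (+ n ℤ.* + e ℤ.- + k) ℤ.- (+ n ℤ.* + e′ ℤ.- + k))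
                                                            (sym (δ-refl c)) (sym (δ-≢ c≢d)) ⟩
    deviation n k c c ℤ.- deviation n k c d           ≡⟨ cong₂ ℤ._-_ (vanishes c) (vanishes d) ⟩
    0ℤ                                                ∎
    where open ≡-Reasoning

φ* : ℕ → (Letter → ℤ) → Letter → ℤ
φ* p g d = weight g (φ-letter p d)

weight-φ : ∀ p g w → weight g (φ p w) ≡ weight (φ* p g) w
weight-φ p g = weight-concatMap g (φ-letter p)

φ*-L : ∀ p g → φ* p g L ≡ + p ℤ.* g L ℤ.+ g S
φ*-L p g = begin
  weight g (replicate p L ++ [ S ])          ≡⟨ weight-++ g (replicate p L) [ S ] ⟩
  weight g (replicate p L) ℤ.+ (g S ℤ.+ 0ℤ)  ≡⟨ cong₂ ℤ._+_ (weight-replicate g p L) (ℤP.+-identityʳ (g S)) ⟩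
  + p ℤ.* g L ℤ.+ g S                        ∎
  where open ≡-Reasoning

-- φ_{r+1}(M) = L^r S = φ_r(L), and + suc r − 1ℤ reduces to + r.
φ*-M : ∀ r g → φ* (suc r) g M ≡ (+ suc r ℤ.- 1ℤ) ℤ.* g L ℤ.+ g S
φ*-M r g = φ*-L r g

iterWeight : ℕ → (Letter → ℤ) → ℕ → ℤ
iterWeight p g a = weight g (φ-iter-L p a)

iterWeight-suc : ∀ p g a → iterWeight p g (suc a) ≡ iterWeight p (φ* p g) a
iterWeight-suc p g a = weight-φ p g (φ-iter-L p a)

iterWeight-zero : ∀ p g → iterWeight p g 0 ≡ g L
iterWeight-zero p g = ℤP.+-identityʳ (g L)

iterWeight-one : ∀ p g → iterWeight p g 1 ≡ φ* p g L
iterWeight-one p g = trans (iterWeight-suc p g 0) (iterWeight-zero p (φ* p g))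

iterWeight-two : ∀ p g → iterWeight p g 2 ≡ φ* p (φ* p g) L
iterWeight-two p g = trans (iterWeight-suc p g 1) (iterWeight-one p (φ* p g))

iterWeight-three : ∀ p g → iterWeight p g 3 ≡ φ* p (φ* p (φ* p g)) L
iterWeight-three p g = trans (iterWeight-suc p g 2) (iterWeight-two p (φ* p g))

module _ (r : ℕ) where

  private
    P : ℤ
    P = + suc r

  -- Cayley–Hamilton at L: the incidence matrix of φ_P has characteristic polynomial t³ − P t² − t + 1.
  φ*-characteristic : ∀ g → φ* (suc r) (φ* (suc r) (φ* (suc r) g)) L ≡
    P ℤ.* φ* (suc r) (φ* (suc r) g) L ℤ.+ φ* (suc r) g L ℤ.- g L
  φ*-characteristic g = begin
    g₃ L                                            ≡⟨ φ*-L (suc r) g₂ ⟩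
    P ℤ.* g₂ L ℤ.+ (g₁ M ℤ.+ 0ℤ)                    ≡⟨ cong (λ t → P ℤ.* g₂ L ℤ.+ (t ℤ.+ 0ℤ)) (φ*-M r g) ⟩
    P ℤ.* g₂ L ℤ.+ ((P ℤ.- 1ℤ) ℤ.* g L ℤ.+ g S ℤ.+ 0ℤ) ≡⟨ regroup P (g₂ L) (g L) (g S) ⟩
    P ℤ.* g₂ L ℤ.+ (P ℤ.* g L ℤ.+ g S) ℤ.- g L       ≡⟨ cong (λ t → P ℤ.* g₂ L ℤ.+ t ℤ.- g L) (sym (φ*-L (suc r) g)) ⟩
    P ℤ.* g₂ L ℤ.+ g₁ L ℤ.- g L                     ∎
    where
    open ≡-Reasoning
    g₁ g₂ g₃ : Letter → ℤ
    g₁ = φ* (suc r) g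
    g₂ = φ* (suc r) g₁
    g₃ = φ* (suc r) g₂
    regroup : ∀ P y l s → P ℤ.* y ℤ.+ ((P ℤ.- 1ℤ) ℤ.* l ℤ.+ s ℤ.+ 0ℤ) ≡ P ℤ.* y ℤ.+ (P ℤ.* l ℤ.+ s) ℤ.- l
    regroup = solve-∀

  iterWeight-recurrence : ∀ g a → iterWeight (suc r) g (3 + a) ≡
    P ℤ.* iterWeight (suc r) g (2 + a) ℤ.+ iterWeight (suc r) g (1 + a) ℤ.- iterWeight (suc r) g a
  iterWeight-recurrence g zero = begin
    X 3                                    ≡⟨ iterWeight-three (suc r) g ⟩
    g₃ L                                   ≡⟨ φ*-characteristic g ⟩
    P ℤ.* g₂ L ℤ.+ g₁ L ℤ.- g L             ≡⟨ cong₂ (λ y z → P ℤ.* y ℤ.+ z ℤ.- g L)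
                                                  (iterWeight-two (suc r) g) (iterWeight-one (suc r) g) ⟨
    P ℤ.* X 2 ℤ.+ X 1 ℤ.- g L               ≡⟨ cong (λ t → P ℤ.* X 2 ℤ.+ X 1 ℤ.- t) (iterWeight-zero (suc r) g) ⟨
    P ℤ.* X 2 ℤ.+ X 1 ℤ.- X 0               ∎
    where
    open ≡-Reasoning
    X : ℕ → ℤ
    X = iterWeight (suc r) g
    g₁ g₂ g₃ : Letter → ℤ
    g₁ = φ* (suc r) g
    g₂ = φ* (suc r) g₁
    g₃ = φ* (suc r) g₂
  iterWeight-recurrence g (suc a)
    rewrite iterWeight-suc (suc r) g (3 + a) | iterWeight-suc (suc r) g (2 + a)
          | iterWeight-suc (suc r) g (1 + a) | iterWeight-suc (suc r) g a
    = iterWeight-recurrence (φ* (suc r) g) a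

iterWeight-initial-zero : ∀ p g → iterWeight p g 0 ≡ 0ℤ → iterWeight p g 1 ≡ 0ℤ → iterWeight p g 2 ≡ 0ℤ →
  ∀ d → g d ≡ 0ℤ
iterWeight-initial-zero p g X₀≡0 X₁≡0 X₂≡0 = λ where
    L → gL≡0
    S → begin
      g S                          ≡⟨ sym (absorb (+ p) (g S)) ⟩
      + p ℤ.* 0ℤ ℤ.+ g S           ≡⟨ cong (λ t → + p ℤ.* t ℤ.+ g S) (sym gL≡0) ⟩
      + p ℤ.* g L ℤ.+ g S          ≡⟨ sym (φ*-L p g) ⟩
      g₁ L                         ≡⟨ g₁L≡0 ⟩
      0ℤ                           ∎
    M → begin
      g M                          ≡⟨ sym (absorb′ (+ p) (g M)) ⟩
      + p ℤ.* 0ℤ ℤ.+ (g M ℤ.+ 0ℤ)   ≡⟨ cong (λ t → + p ℤ.* t ℤ.+ (g M ℤ.+ 0ℤ)) (sym g₁L≡0) ⟩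
      + p ℤ.* g₁ L ℤ.+ g₁ S        ≡⟨ sym (φ*-L p g₁) ⟩
      φ* p g₁ L                    ≡⟨ g₂L≡0 ⟩
      0ℤ                           ∎
  where
  open ≡-Reasoning
  g₁ : Letter → ℤ
  g₁ = φ* p g
  absorb : ∀ P s → P ℤ.* 0ℤ ℤ.+ s ≡ s
  absorb = solve-∀
  absorb′ : ∀ P s → P ℤ.* 0ℤ ℤ.+ (s ℤ.+ 0ℤ) ≡ s
  absorb′ = solve-∀
  gL≡0 : g L ≡ 0ℤ
  gL≡0 = trans (sym (iterWeight-zero p g)) X₀≡0
  g₁L≡0 : g₁ L ≡ 0ℤ
  g₁L≡0 = trans (sym (iterWeight-one p g)) X₁≡0
  g₂L≡0 : φ* p g₁ L ≡ 0ℤ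
  g₂L≡0 = trans (sym (iterWeight-two p g)) X₂≡0

-- The prefixes φ^a(L) of the fixed point

φ-++ : ∀ p w w′ → φ p (w ++ w′) ≡ φ p w ++ φ p w′
φ-++ p = List.concatMap-++ (φ-letter p)

φ-letter-nonempty : ∀ p d → 1 ≤ length (φ-letter p d)
φ-letter-nonempty p       L = List.length-++-≤ʳ [ S ] {replicate p L}
φ-letter-nonempty p       S = ≤-refl
φ-letter-nonempty zero    M = ≤-refl
φ-letter-nonempty (suc p) M = List.length-++-≤ʳ [ S ] {replicate p L}

length-φ : ∀ p w → length w ≤ length (φ p w)
length-φ p []      = z≤n
length-φ p (d ∷ w) = begin
  1 + length w                                   ≤⟨ +-mono-≤ (φ-letter-nonempty p d) (length-φ p w) ⟩
  length (φ-letter p d) + length (φ p w)         ≡⟨ List.length-++ (φ-letter p d) ⟨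
  length (φ p (d ∷ w))                           ∎
  where open ≤-Reasoning

module _ (r : ℕ) where

  private
    A : ℕ → List Letter
    A = φ-iter-L (suc r)

  φ-iter-L-extends : ∀ a → ∃[ w ] A (suc a) ≡ A a ++ w × 1 ≤ length w
  φ-iter-L-extends zero    = (replicate r L ++ [ S ]) ++ [] , refl ,
                             ≤-trans (List.length-++-≤ʳ [ S ] {replicate r L}) (List.length-++-≤ˡ (replicate r L ++ [ S ]))
  φ-iter-L-extends (suc a) with φ-iter-L-extends a
  ... | w , extends , nonempty =
    φ (suc r) w , trans (cong (φ (suc r)) extends) (φ-++ (suc r) (A a) w) , ≤-trans nonempty (length-φ (suc r) w)

  φ-iter-L-prefix : ∀ {a b} → a ≤′ b → ∃[ w ] A b ≡ A a ++ w
  φ-iter-L-prefix ≤′-refl = [] , sym (List.++-identityʳ _)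
  φ-iter-L-prefix {a} (≤′-step {b} a≤b) with φ-iter-L-prefix a≤b | φ-iter-L-extends b
  ... | w , b-extends-a | w′ , b+1-extends-b , _ =
    w ++ w′ , trans b+1-extends-b (trans (cong (_++ w′) b-extends-a) (List.++-assoc (A a) w w′))

  length-φ-iter-L-mono : ∀ {a b} → a ≤ b → length (A a) ≤ length (A b)
  length-φ-iter-L-mono {a} a≤b with φ-iter-L-prefix (≤⇒≤′ a≤b)
  ... | w , extends = ≤-trans (List.length-++-≤ˡ (A a)) (≤-reflexive (cong length (sym extends)))

  a<length-φ-iter-L : ∀ a → a < length (A a)
  a<length-φ-iter-L zero    = ≤-refl
  a<length-φ-iter-L (suc a) with φ-iter-L-extends a
  ... | w , extends , nonempty = begin
    suc (suc a)                ≤⟨ +-mono-≤ nonempty (a<length-φ-iter-L a) ⟩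
    length w + length (A a)    ≡⟨ +-comm (length w) _ ⟩
    length (A a) + length w    ≡⟨ List.length-++ (A a) ⟨
    length (A a ++ w)          ≡⟨ cong length extends ⟨
    length (A (suc a))         ∎
    where open ≤-Reasoning

  u-nth : ∀ a t → t < length (A a) → u (suc r) t ≡ nth (A a) t
  u-nth a t t<|Aa| with ≤-total a (suc t)
  ... | inj₁ a≤t+1 with φ-iter-L-prefix (≤⇒≤′ a≤t+1)
  ...   | w , extends = trans (cong (λ w′ → nth w′ t) extends) (nth-++ (A a) w t<|Aa|)
  u-nth a t t<|Aa| | inj₂ t+1≤a with φ-iter-L-prefix (≤⇒≤′ t+1≤a)
  ...   | w , extends = sym (trans (cong (λ w′ → nth w′ t) extends)
                          (nth-++ (A (suc t)) w (≤-trans (n≤1+n (suc t)) (a<length-φ-iter-L (suc t)))))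

  window-φ-iter-L : ∀ a → window (u (suc r)) 0 (length (A a)) ≡ A a
  window-φ-iter-L a = window-nth (u (suc r)) (A a) (u-nth a)

-- Prefix deviations of a periodic indicator

∣+m-+n∣≤ : ∀ {m n o} → m ≤ o → n ≤ o → ∣ + m ℤ.- + n ∣ ≤ o
∣+m-+n∣≤ {m} {n} {o} m≤o n≤o = begin
  ∣ + m ℤ.- + n ∣  ≡⟨ cong ∣_∣ (ℤP.[+m]-[+n]≡m⊖n m n) ⟩
  ∣ m ⊖ n ∣        ≤⟨ ℤP.∣m⊝n∣≤m⊔n m n ⟩
  m ⊔ n            ≤⟨ ⊔-lub m≤o n≤o ⟩
  o                ∎
  where open ≤-Reasoning

module _ (v : ℕ → Letter) (c : Letter) (n B : ℕ)
         (periodic : ∀ j → j < B → δ c (v j) ≡ δ c (v (j + n))) where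

  count-window-constant : ∀ j → j ≤ B → count c (window v j n) ≡ count c (window v 0 n)
  count-window-constant zero    _   = refl
  count-window-constant (suc j) j<B =
    trans (δ≡⇒count-window-suc≡ v c j n (periodic j j<B)) (count-window-constant j (<⇒≤ j<B))

  -- All windows at positions ≤ B hold the same number of c's, so the deviation of a prefix is
  -- n-periodic in its length up to B, and at most n² for lengths ≤ n.
  deviation-bounded : 1 ≤ n → ∀ N → N ≤ B →
    ∣ weight (deviation n (count c (window v 0 n)) c) (window v 0 N) ∣ ≤ n * n
  deviation-bounded 1≤n = <-rec _ bounded
    where
    k : ℕ
    k = count c (window v 0 n)
    E : ℕ → ℤ
    E N = weight (deviation n k c) (window v 0 N)

    E≡ : ∀ i N → weight (deviation n k c) (window v i N) ≡ + n ℤ.* + count c (window v i N) ℤ.- + k ℤ.* + N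
    E≡ i N = trans (weight-deviation n k c (window v i N))
                   (cong (λ ℓ → + n ℤ.* + count c (window v i N) ℤ.- + k ℤ.* + ℓ) (length-window v i N))

    E-periodic : ∀ N → N ≤ B → E (N + n) ≡ E N
    E-periodic N N≤B = begin
      E (N + n)                                                  ≡⟨ cong (weight (deviation n k c)) (window-+ v 0 N n) ⟩
      weight (deviation n k c) (window v 0 N ++ window v N n)     ≡⟨ weight-++ (deviation n k c) (window v 0 N) _ ⟩
      E N ℤ.+ weight (deviation n k c) (window v N n)             ≡⟨ cong (ℤ._+_ (E N)) (E≡ N n) ⟩
      E N ℤ.+ (+ n ℤ.* + count c (window v N n) ℤ.- + k ℤ.* + n)  ≡⟨ cong (λ t → E N ℤ.+ (+ n ℤ.* + t ℤ.- + k ℤ.* + n))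
                                                                       (count-window-constant N N≤B) ⟩
      E N ℤ.+ (+ n ℤ.* + k ℤ.- + k ℤ.* + n)                       ≡⟨ cancel (E N) (+ n) (+ k) ⟩
      E N                                                        ∎
      where
      open ≡-Reasoning
      cancel : ∀ e n k → e ℤ.+ (n ℤ.* k ℤ.- k ℤ.* n) ≡ e
      cancel = solve-∀

    E-small : ∀ N → N ≤ n → ∣ E N ∣ ≤ n * n
    E-small N N≤n = begin
      ∣ E N ∣                                                ≡⟨ cong ∣_∣ (E≡ 0 N) ⟩
      ∣ + n ℤ.* + count c (window v 0 N) ℤ.- + k ℤ.* + N ∣    ≡⟨ cong₂ (λ x y → ∣ x ℤ.- y ∣) (ℤP.pos-* n _) (ℤP.pos-* k N) ⟨
      ∣ + (n * count c (window v 0 N)) ℤ.- + (k * N) ∣        ≤⟨ ∣+m-+n∣≤ (*-monoʳ-≤ n count≤n) (*-mono-≤ k≤n N≤n) ⟩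
      n * n                                                  ∎
      where
      open ≤-Reasoning
      count≤n : count c (window v 0 N) ≤ n
      count≤n = ≤-trans (count≤length c (window v 0 N)) (≤-trans (≤-reflexive (length-window v 0 N)) N≤n)
      k≤n : k ≤ n
      k≤n = ≤-trans (count≤length c (window v 0 n)) (≤-reflexive (length-window v 0 n))

    bounded : ∀ N → (∀ {M} → M < N → M ≤ B → ∣ E M ∣ ≤ n * n) → N ≤ B → ∣ E N ∣ ≤ n * n
    bounded N rec N≤B with N ≤? n
    ... | yes N≤n = E-small N N≤n
    ... | no  N≰n = subst (λ N′ → ∣ E N′ ∣ ≤ n * n) (m∸n+n≡m n≤N) (begin
      ∣ E (N ∸ n + n) ∣  ≡⟨ cong ∣_∣ (E-periodic (N ∸ n) N∸n≤B) ⟩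
      ∣ E (N ∸ n) ∣      ≤⟨ rec (∸-monoʳ-< 1≤n n≤N) N∸n≤B ⟩
      n * n              ∎)
      where
      open ≤-Reasoning
      n≤N : n ≤ N
      n≤N = <⇒≤ (≰⇒> N≰n)
      N∸n≤B : N ∸ n ≤ B
      N∸n≤B = ≤-trans (m∸n≤m N n) N≤B

-- Linear recurrences with a Lyapunov function

+∣i∣*∣i∣≡i*i : ∀ i → + (∣ i ∣ * ∣ i ∣) ≡ i ℤ.* i
+∣i∣*∣i∣≡i*i (+ m)    = ℤP.pos-* m m
+∣i∣*∣i∣≡i*i -[1+ m ] = refl

∣i∣*∣i∣≡0⇒i≡0 : ∀ i → ∣ i ∣ * ∣ i ∣ ≡ 0 → i ≡ 0ℤ
∣i∣*∣i∣≡0⇒i≡0 i ∣i∣²≡0 with m*n≡0⇒m≡0∨n≡0 ∣ i ∣ ∣i∣²≡0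
... | inj₁ ∣i∣≡0 = ℤP.∣i∣≡0⇒i≡0 ∣i∣≡0
... | inj₂ ∣i∣≡0 = ℤP.∣i∣≡0⇒i≡0 ∣i∣≡0

module _ (q : ℕ) (x : ℕ → ℤ)
         (x-rec : ∀ a → x (3 + a) ≡ + (2 + q) ℤ.* x (2 + a) ℤ.+ x (1 + a) ℤ.- x a) where

  private
    V : ℕ → ℤ
    V a = + 2 ℤ.* x (2 + a) ℤ.* x (1 + a) ℤ.- x a ℤ.* x a ℤ.- x (1 + a) ℤ.* x (1 + a)

    Δ : ℕ → ℕ
    Δ a = ∣ x a ℤ.- x (2 + a) ∣ * ∣ x a ℤ.- x (2 + a) ∣ + 2 * suc q * (∣ x (2 + a) ∣ * ∣ x (2 + a) ∣)

    V-step : ∀ a → V (1 + a) ≡ V a ℤ.+ + Δ a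
    V-step a = begin
      V (1 + a)
        ≡⟨ cong (λ t → + 2 ℤ.* t ℤ.* x₂ ℤ.- x₁ ℤ.* x₁ ℤ.- x₂ ℤ.* x₂) (x-rec a) ⟩
      + 2 ℤ.* ((1ℤ ℤ.+ Q) ℤ.* x₂ ℤ.+ x₁ ℤ.- x₀) ℤ.* x₂ ℤ.- x₁ ℤ.* x₁ ℤ.- x₂ ℤ.* x₂
        ≡⟨ lyapunov Q x₀ x₁ x₂ ⟩
      V a ℤ.+ ((x₀ ℤ.- x₂) ℤ.* (x₀ ℤ.- x₂) ℤ.+ + 2 ℤ.* Q ℤ.* (x₂ ℤ.* x₂))
        ≡⟨ cong (ℤ._+_ (V a)) (cong₂ ℤ._+_ (+∣i∣*∣i∣≡i*i (x₀ ℤ.- x₂))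
             (trans (ℤP.pos-* (2 * suc q) _) (cong₂ ℤ._*_ (ℤP.pos-* 2 (suc q)) (+∣i∣*∣i∣≡i*i x₂)))) ⟨
      V a ℤ.+ + Δ a ∎
      where
      open ≡-Reasoning
      Q x₀ x₁ x₂ : ℤ
      Q = + suc q
      x₀ = x a
      x₁ = x (1 + a)
      x₂ = x (2 + a)
      lyapunov : ∀ Q x₀ x₁ x₂ →
        + 2 ℤ.* ((1ℤ ℤ.+ Q) ℤ.* x₂ ℤ.+ x₁ ℤ.- x₀) ℤ.* x₂ ℤ.- x₁ ℤ.* x₁ ℤ.- x₂ ℤ.* x₂ ≡
        (+ 2 ℤ.* x₂ ℤ.* x₁ ℤ.- x₀ ℤ.* x₀ ℤ.- x₁ ℤ.* x₁) ℤ.+ ((x₀ ℤ.- x₂) ℤ.* (x₀ ℤ.- x₂) ℤ.+ + 2 ℤ.* Q ℤ.* (x₂ ℤ.* x₂))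
      lyapunov = solve-∀

    Δ≡0⇒ : ∀ a → Δ a ≡ 0 → x a ≡ 0ℤ × x (2 + a) ≡ 0ℤ
    Δ≡0⇒ a Δ≡0 = trans (ℤP.i-j≡0⇒i≡j (x a) (x (2 + a)) diff≡0) x₂≡0 , x₂≡0
      where
      diff≡0 : x a ℤ.- x (2 + a) ≡ 0ℤ
      diff≡0 = ∣i∣*∣i∣≡0⇒i≡0 (x a ℤ.- x (2 + a)) (m+n≡0⇒m≡0 _ Δ≡0)
      x₂≡0 : x (2 + a) ≡ 0ℤ
      x₂≡0 with m*n≡0⇒m≡0∨n≡0 (2 * suc q) (m+n≡0⇒n≡0 (∣ x a ℤ.- x (2 + a) ∣ * ∣ x a ℤ.- x (2 + a) ∣) Δ≡0)
      ... | inj₂ ∣x₂∣²≡0 = ∣i∣*∣i∣≡0⇒i≡0 (x (2 + a)) ∣x₂∣²≡0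

    NonzeroTriple : ℕ → Set
    NonzeroTriple a = ¬ (x a ≡ 0ℤ × x (1 + a) ≡ 0ℤ × x (2 + a) ≡ 0ℤ)

    nonzero-triple-suc : ∀ a → NonzeroTriple a → NonzeroTriple (1 + a)
    nonzero-triple-suc a nonzero (x₁≡0 , x₂≡0 , x₃≡0) = nonzero (x₀≡0 , x₁≡0 , x₂≡0)
      where
      back : ∀ P x₀ x₁ x₂ → x₀ ≡ P ℤ.* x₂ ℤ.+ x₁ ℤ.- (P ℤ.* x₂ ℤ.+ x₁ ℤ.- x₀)
      back = solve-∀
      vanish : ∀ P → P ℤ.* 0ℤ ℤ.+ 0ℤ ℤ.- 0ℤ ≡ 0ℤ
      vanish = solve-∀
      x₀≡0 : x a ≡ 0ℤ
      x₀≡0 = begin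
        x a                                                         ≡⟨ back (+ (2 + q)) (x a) (x (1 + a)) (x (2 + a)) ⟩
        + (2 + q) ℤ.* x (2 + a) ℤ.+ x (1 + a) ℤ.- (+ (2 + q) ℤ.* x (2 + a) ℤ.+ x (1 + a) ℤ.- x a)
                                                                    ≡⟨ cong (λ t → + (2 + q) ℤ.* x (2 + a) ℤ.+ x (1 + a) ℤ.- t) (x-rec a) ⟨
        + (2 + q) ℤ.* x (2 + a) ℤ.+ x (1 + a) ℤ.- x (3 + a)          ≡⟨ cong₂ (λ y z → + (2 + q) ℤ.* y ℤ.+ x (1 + a) ℤ.- z) x₂≡0 x₃≡0 ⟩
        + (2 + q) ℤ.* 0ℤ ℤ.+ x (1 + a) ℤ.- 0ℤ                       ≡⟨ cong (λ t → + (2 + q) ℤ.* 0ℤ ℤ.+ t ℤ.- 0ℤ) x₁≡0 ⟩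
        + (2 + q) ℤ.* 0ℤ ℤ.+ 0ℤ ℤ.- 0ℤ                              ≡⟨ vanish (+ (2 + q)) ⟩
        0ℤ                                                          ∎
        where open ≡-Reasoning

    Δ-pair-positive : ∀ a → NonzeroTriple a → 1 ≤ Δ a + Δ (1 + a)
    Δ-pair-positive a nonzero = n≢0⇒n>0 λ sum≡0 →
      let x₀≡0 , x₂≡0 = Δ≡0⇒ a (m+n≡0⇒m≡0 _ sum≡0)
          x₁≡0 , _    = Δ≡0⇒ (1 + a) (m+n≡0⇒n≡0 (Δ a) sum≡0)
      in nonzero (x₀≡0 , x₁≡0 , x₂≡0)

    V-grows : (∀ a → NonzeroTriple a) → ∀ m → ∃[ s ] V (m * 2) ≡ V 0 ℤ.+ + s × m ≤ s
    V-grows nonzero zero    = 0 , sym (ℤP.+-identityʳ (V 0)) , z≤n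
    V-grows nonzero (suc m) with V-grows nonzero m
    ... | s , V≡ , m≤s = Δ₂ + s , V≡′ , +-mono-≤ (Δ-pair-positive (m * 2) (nonzero (m * 2))) m≤s
      where
      Δ₂ : ℕ
      Δ₂ = Δ (m * 2) + Δ (1 + m * 2)
      reorder : ∀ v s d d′ → v ℤ.+ s ℤ.+ d ℤ.+ d′ ≡ v ℤ.+ ((d ℤ.+ d′) ℤ.+ s)
      reorder = solve-∀
      V≡′ : V (2 + m * 2) ≡ V 0 ℤ.+ + (Δ₂ + s)
      V≡′ = begin
        V (2 + m * 2)                                              ≡⟨ V-step (1 + m * 2) ⟩
        V (1 + m * 2) ℤ.+ + Δ (1 + m * 2)                          ≡⟨ cong (λ t → t ℤ.+ + Δ (1 + m * 2)) (V-step (m * 2)) ⟩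
        V (m * 2) ℤ.+ + Δ (m * 2) ℤ.+ + Δ (1 + m * 2)              ≡⟨ cong (λ t → t ℤ.+ + Δ (m * 2) ℤ.+ + Δ (1 + m * 2)) V≡ ⟩
        V 0 ℤ.+ + s ℤ.+ + Δ (m * 2) ℤ.+ + Δ (1 + m * 2)            ≡⟨ reorder (V 0) (+ s) (+ Δ (m * 2)) (+ Δ (1 + m * 2)) ⟩
        V 0 ℤ.+ + (Δ₂ + s)                                         ∎
        where open ≡-Reasoning

    ∣V∣≤ : ∀ {D} a → ∣ x a ∣ ≤ D → ∣ x (1 + a) ∣ ≤ D → ∣ x (2 + a) ∣ ≤ D → ∣ V a ∣ ≤ 4 * (D * D)
    ∣V∣≤ {D} a ∣x₀∣≤D ∣x₁∣≤D ∣x₂∣≤D = begin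
      ∣ V a ∣
        ≤⟨ ℤP.∣i-j∣≤∣i∣+∣j∣ (+ 2 ℤ.* x₂ ℤ.* x₁ ℤ.- x₀ ℤ.* x₀) (x₁ ℤ.* x₁) ⟩
      ∣ + 2 ℤ.* x₂ ℤ.* x₁ ℤ.- x₀ ℤ.* x₀ ∣ + ∣ x₁ ℤ.* x₁ ∣
        ≤⟨ +-monoˡ-≤ _ (ℤP.∣i-j∣≤∣i∣+∣j∣ (+ 2 ℤ.* x₂ ℤ.* x₁) (x₀ ℤ.* x₀)) ⟩
      ∣ + 2 ℤ.* x₂ ℤ.* x₁ ∣ + ∣ x₀ ℤ.* x₀ ∣ + ∣ x₁ ℤ.* x₁ ∣
        ≡⟨ cong₂ _+_ (cong₂ _+_ (trans (ℤP.abs-* (+ 2 ℤ.* x₂) x₁) (cong (_* ∣ x₁ ∣) (ℤP.abs-* (+ 2) x₂)))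
                               (ℤP.abs-* x₀ x₀))
                     (ℤP.abs-* x₁ x₁) ⟩
      2 * ∣ x₂ ∣ * ∣ x₁ ∣ + ∣ x₀ ∣ * ∣ x₀ ∣ + ∣ x₁ ∣ * ∣ x₁ ∣
        ≤⟨ +-mono-≤ (+-mono-≤ (*-mono-≤ (*-monoʳ-≤ 2 ∣x₂∣≤D) ∣x₁∣≤D) (*-mono-≤ ∣x₀∣≤D ∣x₀∣≤D)) (*-mono-≤ ∣x₁∣≤D ∣x₁∣≤D) ⟩
      2 * D * D + D * D + D * D
        ≡⟨ collect D ⟩
      4 * (D * D) ∎
      where
      open ≤-Reasoning
      x₀ x₁ x₂ : ℤ
      x₀ = x a
      x₁ = x (1 + a)
      x₂ = x (2 + a)
      collect : ∀ D → 2 * D * D + D * D + D * D ≡ 4 * (D * D)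
      collect = ℕ-Solver.solve-∀

  recurrence-unbounded : ¬ (x 0 ≡ 0ℤ × x 1 ≡ 0ℤ × x 2 ≡ 0ℤ) → ∀ D → ∃[ K ] ¬ (∀ a → a ≤ K → ∣ x a ∣ ≤ D)
  recurrence-unbounded nonzero₀ D = 2 + m * 2 , impossible
    where
    m : ℕ
    m = suc (8 * (D * D))
    nonzero : ∀ a → NonzeroTriple a
    nonzero zero    = nonzero₀
    nonzero (suc a) = nonzero-triple-suc a (nonzero a)
    impossible : ¬ (∀ a → a ≤ 2 + m * 2 → ∣ x a ∣ ≤ D)
    impossible bounded = <-irrefl refl (begin-strict
      8 * (D * D)                      <⟨ m≤s ⟩
      s                                ≡⟨ cong ∣_∣ (trans (cong (ℤ._- V 0) V≡) (cancel (V 0) (+ s))) ⟨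
      ∣ V (m * 2) ℤ.- V 0 ∣            ≤⟨ ℤP.∣i-j∣≤∣i∣+∣j∣ (V (m * 2)) (V 0) ⟩
      ∣ V (m * 2) ∣ + ∣ V 0 ∣          ≤⟨ +-mono-≤ (∣V∣-bounded (m * 2) ≤-refl) (∣V∣-bounded 0 (s≤s (s≤s z≤n))) ⟩
      4 * (D * D) + 4 * (D * D)        ≡⟨ double (D * D) ⟩
      8 * (D * D)                      ∎)
      where
      open ≤-Reasoning
      growth : ∃[ s ] V (m * 2) ≡ V 0 ℤ.+ + s × m ≤ s
      growth = V-grows nonzero m
      s : ℕ
      s = proj₁ growth
      V≡ : V (m * 2) ≡ V 0 ℤ.+ + s
      V≡ = proj₁ (proj₂ growth)
      m≤s : m ≤ s
      m≤s = proj₂ (proj₂ growth)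
      cancel : ∀ y z → y ℤ.+ z ℤ.- y ≡ z
      cancel = solve-∀
      double : ∀ X → 4 * X + 4 * X ≡ 8 * X
      double = ℕ-Solver.solve-∀
      ∣V∣-bounded : ∀ a → 2 + a ≤ 2 + m * 2 → ∣ V a ∣ ≤ 4 * (D * D)
      ∣V∣-bounded a a+2≤K = ∣V∣≤ a (bounded a (≤-trans (m≤n+m a 2) a+2≤K))
                                   (bounded (1 + a) (≤-trans (n≤1+n (1 + a)) a+2≤K)) (bounded (2 + a) a+2≤K)

-- Aperiodicity of the letter indicators of u

¬∀<⇒∃¬ : ∀ {P : ℕ → Set} → (∀ j → Dec (P j)) → ∀ B → ¬ (∀ j → j < B → P j) → ∃[ j ] ¬ P j
¬∀<⇒∃¬ P? B ¬all with anyUpTo? (¬? ∘ P?) B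
... | yes (j , _ , ¬Pj) = j , ¬Pj
... | no  none          = contradiction (λ j j<B → decidable-stable (P? j) λ ¬Pj → none (j , j<B , ¬Pj)) ¬all

indicator-not-periodic-on-prefix : ∀ q c n → 1 ≤ n →
  ∃[ B ] ¬ (∀ j → j < B → δ c (u (2 + q) j) ≡ δ c (u (2 + q) (j + n)))
indicator-not-periodic-on-prefix q c n 1≤n = B , not-periodic
  where
  v : ℕ → Letter
  v = u (2 + q)
  g : Letter → ℤ
  g = deviation n (count c (window v 0 n)) c
  x : ℕ → ℤ
  x = iterWeight (2 + q) g
  x-nonzero : ¬ (x 0 ≡ 0ℤ × x 1 ≡ 0ℤ × x 2 ≡ 0ℤ)
  x-nonzero (x₀≡0 , x₁≡0 , x₂≡0) =
    deviation-nonvanishing _ c 1≤n (iterWeight-initial-zero (2 + q) g x₀≡0 x₁≡0 x₂≡0)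
  x-unbounded : ∃[ K ] ¬ (∀ a → a ≤ K → ∣ x a ∣ ≤ n * n)
  x-unbounded = recurrence-unbounded q x (iterWeight-recurrence (suc q) g) x-nonzero (n * n)
  B : ℕ
  B = length (φ-iter-L (2 + q) (proj₁ x-unbounded))
  not-periodic : ¬ (∀ j → j < B → δ c (v j) ≡ δ c (v (j + n)))
  not-periodic periodic = proj₂ x-unbounded λ a a≤K →
    subst (λ w → ∣ weight g w ∣ ≤ n * n) (window-φ-iter-L (suc q) a)
      (deviation-bounded v c n B periodic 1≤n _ (length-φ-iter-L-mono (suc q) a≤K))

indicator-aperiodic : ∀ q c n → 1 ≤ n → ∃[ j ] δ c (u (2 + q) j) ≢ δ c (u (2 + q) (j + n))
indicator-aperiodic q c n 1≤n =
  uncurry (¬∀<⇒∃¬ (λ j → δ c (u (2 + q) j) ≟ δ c (u (2 + q) (j + n)))) (indicator-not-periodic-on-prefix q c n 1≤n)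

proposition7 : (p : ℕ) → 2 ≤ p → (n : ℕ) → 1 ≤ n →
    Σ ℕ λ i → Σ ℕ λ j → Σ ℕ λ k →
      (Ψ (factor p i n) ≢ Ψ (factor p j n)) ×
      (Ψ (factor p i n) ≢ Ψ (factor p k n)) ×
      (Ψ (factor p j n) ≢ Ψ (factor p k n))
proposition7 p@(suc (suc q)) (s≤s (s≤s z≤n)) n 1≤n =
  ThreeParikhVectors-cong (λ i → sym (factor≡window p i n))
    (three-Parikh-vectors-in-windows (u p) n (λ c → indicator-aperiodic q c n 1≤n))
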